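{- Let $m$ be a positive integer with $m\equiv0\pmod4$, let $u$ be a complex number with $u^4=1$, and let $a$ be a primitive $2m^2$-th root of unity. Let $W$ be the matrix indexed by $\mathbb{Z}_{m^2}$ (identified with $\{0,\dots,m^2-1\}$) with $W(\alpha,\beta)=a^{(\beta-\alpha)(\beta-\alpha-m)}$. Then $W_{(1),u,a}$ is equivalent to $W$, i.e. there exist a bijection $\psi:\mathbb{Z}_m\times\mathbb{Z}_m\to\mathbb{Z}_{m^2}$ and a complex number $c$ with $c^4=1$ such that $c\,W(\psi(\alpha),\psi(\beta))=W_{(1),u,a}(\alpha,\beta)$ for all $\alpha,\beta\in\mathbb{Z}_m\times\mathbb{Z}_m$.
   Context: Identify $\mathbb{Z}_m$ with $\{0,\dots,m-1\}$. $W_{(1),u,a}$ is the matrix indexed by $\mathbb{Z}_m\times\mathbb{Z}_m$ with $W_{(1),u,a}((i,\ell),(j,\ell'))=a^{2m(\ell-\ell')(i-j)+(i-j)^2+m(i-j)}\,u^3$ if $i-j$ is even, and $=a^{2m(\ell-\ell')(i-j)+(i-j)^2+m(i-j)}$ if $i-j$ is odd (the spin model of index $m$ built from the $1\times1$ Hadamard matrix $(1)$ and the $1\times1$ Potts model $(u^3)$). -}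

module Defs where

-- Model: the complex 2m²-th roots of unity form a cyclic group generated by the
-- primitive root a; every such root (in particular every 4th root of unity, since
-- 4 ∣ 2m² when 4 ∣ m) is a^k with k determined modulo 2m².  We therefore represent
-- a complex number a^k by its exponent k : ℤ, and equality of such numbers by
-- congruence of exponents modulo 2m².

open import Data.Nat as ℕ using (ℕ; _≡ᵇ_; _%_)
open import Data.Integer using (ℤ; +_; _+_; _-_; _*_)
open import Data.Integer.Divisibility using (_∣_)
open import Data.Fin using (Fin; toℕ)
open import Data.Product using (_×_; _,_)
open import Data.Bool using (if_then_else_)

N : ℕ → ℤ
N m = + (2 ℕ.* m ℕ.* m)

_≡[_]_ : ℤ → ℕ → ℤ → Set
x ≡[ m ] y = N m ∣ (x - y)

-- z := a^k satisfies z^4 = 1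
FourthRoot : ℕ → ℤ → Set
FourthRoot m k = N m ∣ (+ 4 * k)

Wexp : (m : ℕ) → Fin (m ℕ.* m) → Fin (m ℕ.* m) → ℤ
Wexp m α β = (+ toℕ β - + toℕ α) * (+ toℕ β - + toℕ α - + m)

-- exponent (base a) of W_{(1),u,a}((i,ℓ),(j,ℓ')) where u = a^e
W1exp : (m : ℕ) → (e : ℤ) → Fin m × Fin m → Fin m × Fin m → ℤ
W1exp m e (i , ℓ) (j , ℓ') =
  let d = + toℕ i - + toℕ j
      base = + (2 ℕ.* m) * (+ toℕ ℓ - + toℕ ℓ') * d + d * d + + m * d
  in if ((toℕ i ℕ.+ toℕ j) % 2) ≡ᵇ 0 then base + + 3 * e else base

{-# OPTIONS --safe #-}
module Submission where

-- Write u = a^e.  Since u⁴ = 1 and 4 ∣ m, e = 2m·h for some integer h; put s = h mod m, so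
-- that e ≡ 2ms (mod 2m²).  The bijection is ψ(i, ℓ) = m·((ℓ + s·i) mod m) + i, a shear of
-- Z_m × Z_m followed by the mixed-radix encoding.  With δ = i - j the difference
-- D = ψ(j, ℓ′) - ψ(i, ℓ) satisfies -D = δ + m·X where X ≡ ℓ - ℓ′ + s·δ (mod m), and expanding
-- D(D - m) modulo 2m², using that X(X + 1) is even, yields the exponent of W_{(1),u,a}
-- except for the u³ factor and an extra term 2msδ² ≡ eδ².  As 4e ≡ 0, eδ² is 0 for even δ
-- and e for odd δ, so the constant c = u³ = a^{3e} reconciles both parities.

open import Defs
open import Data.Nat using (ℕ; _<_; _*_)
open import Data.Nat.Divisibility using (_∣_)
open import Data.Integer using (ℤ) renaming (_+_ to _+ℤ_)
open import Data.Fin using (Fin)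
open import Data.Product using (_×_; Σ)
open import Function.Bundles using (_⤖_; Bijection)

open import Data.Nat as ℕ using (NonZero; pred)
import Data.Nat.Properties as ℕ
import Data.Nat.Divisibility as ℕ
open import Data.Nat.DivMod using (_%_; _/_; m≡m%n+[m/n]*n; m%n<n; %-distribˡ-+; m%n%n≡m%n; %-remove-+ʳ; m<n⇒m%n≡m)
open import Data.Nat.Tactic.RingSolver using () renaming (solve-∀ to ℕ-solve-∀)
open import Data.Integer using (+_; -_; _-_) renaming (_*_ to _*ℤ_)
import Data.Integer.Properties as ℤ
open import Data.Integer.Tactic.RingSolver using (solve-∀)
open import Data.Integer.Divisibility.Signed as Signed using (divides; ∣⇒∣ᵤ; ∣ᵤ⇒∣)
open import Data.Integer.DivMod using (_%ℕ_; _/ℕ_; a≡a%ℕn+[a/ℕn]*n; n%ℕd<d)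
open import Data.Fin using (toℕ; fromℕ<; combine; remQuot)
open import Data.Fin.Properties using (toℕ-fromℕ<; toℕ-injective; toℕ<n; toℕ-combine; remQuot-combine; combine-remQuot)
open import Data.Product using (_,_; ∃; uncurry)
open import Data.Sum using (_⊎_; inj₁; inj₂)
open import Function.Bundles using (_↔_; mk↔ₛ′)
open import Function.Properties.Inverse using (↔⇒⤖)
open import Relation.Binary.Bundles using (Setoid)
open import Relation.Binary.Structures using (IsEquivalence)
import Relation.Binary.Reasoning.Setoid
open import Relation.Binary.PropositionalEquality using (_≡_; refl; sym; trans; cong; cong₂; subst; module ≡-Reasoning)

module Modulo (n : ℤ) where

  -- a record rather than a synonym for n ∣ x - y, so that x and y are inferable from x ≈ y
  infix 4 _≈_
  record _≈_ (x y : ℤ) : Set where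
    constructor ∣⇒≈
    field ≈⇒∣ : n Signed.∣ x - y
  open _≈_ public

  ≈-by : ∀ {x y} q → x ≡ y +ℤ q *ℤ n → x ≈ y
  ≈-by {y = y} q refl = ∣⇒≈ (divides q (cancel y (q *ℤ n)))
    where
    cancel : ∀ y z → y +ℤ z - y ≡ z
    cancel = solve-∀

  ≈-isEquivalence : IsEquivalence _≈_
  ≈-isEquivalence = record
    { refl  = λ {x} → ≈-by (+ 0) (add-zero x n)
    ; sym   = λ {x} {y} (∣⇒≈ x-y) → ∣⇒≈ (subst (n Signed.∣_) (flip x y) (Signed.∣m⇒∣-m x-y))
    ; trans = λ {x} {y} {z} (∣⇒≈ x-y) (∣⇒≈ y-z) →
                ∣⇒≈ (subst (n Signed.∣_) (split x y z) (Signed.∣m∣n⇒∣m+n x-y y-z))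
    }
    where
    add-zero : ∀ x n → x ≡ x +ℤ + 0 *ℤ n
    add-zero = solve-∀
    flip : ∀ x y → - (x - y) ≡ y - x
    flip = solve-∀
    split : ∀ x y z → (x - y) +ℤ (y - z) ≡ x - z
    split = solve-∀

  open IsEquivalence ≈-isEquivalence public using () renaming (sym to ≈-sym; trans to ≈-trans)

  ≈-setoid : Setoid _ _
  ≈-setoid = record { isEquivalence = ≈-isEquivalence }

  module ≈-Reasoning = Relation.Binary.Reasoning.Setoid ≈-setoid

  +-congˡ : ∀ k {a b} → a ≈ b → k +ℤ a ≈ k +ℤ b
  +-congˡ k {a} {b} (∣⇒≈ a-b) = ∣⇒≈ (subst (n Signed.∣_) (cancel k a b) a-b)
    where
    cancel : ∀ k a b → a - b ≡ (k +ℤ a) - (k +ℤ b)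
    cancel = solve-∀

  *-congʳ : ∀ k {a b} → a ≈ b → a *ℤ k ≈ b *ℤ k
  *-congʳ k {a} {b} (∣⇒≈ a-b) = ∣⇒≈ (subst (n Signed.∣_) (distrib k a b) (Signed.∣m⇒∣m*n k a-b))
    where
    distrib : ∀ k a b → (a - b) *ℤ k ≡ a *ℤ k - b *ℤ k
    distrib = solve-∀

  ∣⇒≈0 : ∀ {x} → n Signed.∣ x → x ≈ + 0
  ∣⇒≈0 {x} (divides q x≡qn) = ≈-by q (trans x≡qn (sym (ℤ.+-identityˡ (q *ℤ n))))

  e[r+2w]²≈er² : ∀ {e} → n Signed.∣ + 4 *ℤ e → ∀ r w →
                 e *ℤ ((r +ℤ + 2 *ℤ w) *ℤ (r +ℤ + 2 *ℤ w)) ≈ e *ℤ (r *ℤ r)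
  e[r+2w]²≈er² {e} (divides q 4e≡qn) r w = ≈-by (c *ℤ q) (begin
    e *ℤ ((r +ℤ + 2 *ℤ w) *ℤ (r +ℤ + 2 *ℤ w))  ≡⟨ expand e r w ⟩
    e *ℤ (r *ℤ r) +ℤ c *ℤ (+ 4 *ℤ e)            ≡⟨ cong (λ x → e *ℤ (r *ℤ r) +ℤ c *ℤ x) 4e≡qn ⟩
    e *ℤ (r *ℤ r) +ℤ c *ℤ (q *ℤ n)              ≡⟨ cong (e *ℤ (r *ℤ r) +ℤ_) (ℤ.*-assoc c q n) ⟨
    e *ℤ (r *ℤ r) +ℤ c *ℤ q *ℤ n                ∎)
    where
    open ≡-Reasoning
    c = r *ℤ w +ℤ w *ℤ w
    expand : ∀ e r w →
      e *ℤ ((r +ℤ + 2 *ℤ w) *ℤ (r +ℤ + 2 *ℤ w)) ≡ e *ℤ (r *ℤ r) +ℤ (r *ℤ w +ℤ w *ℤ w) *ℤ (+ 4 *ℤ e)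
    expand = solve-∀

r<2⇒r≡0⊎r≡1 : ∀ {r} → r < 2 → r ≡ 0 ⊎ r ≡ 1
r<2⇒r≡0⊎r≡1 {0} _ = inj₁ refl
r<2⇒r≡0⊎r≡1 {1} _ = inj₂ refl
r<2⇒r≡0⊎r≡1 {ℕ.suc (ℕ.suc _)} (ℕ.s≤s (ℕ.s≤s ()))

x[x+1]-even : ∀ x → ∃ λ v → x *ℤ (x +ℤ + 1) ≡ + 2 *ℤ v
x[x+1]-even x with r<2⇒r≡0⊎r≡1 (n%ℕd<d x 2) | a≡a%ℕn+[a/ℕn]*n x 2
... | inj₁ r≡0 | x≡ rewrite r≡0 = _ , trans (cong (λ y → y *ℤ (y +ℤ + 1)) x≡) (even-case (x /ℕ 2))
  where
  even-case : ∀ w → (+ 0 +ℤ w *ℤ + 2) *ℤ ((+ 0 +ℤ w *ℤ + 2) +ℤ + 1) ≡ + 2 *ℤ (w *ℤ (+ 2 *ℤ w +ℤ + 1))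
  even-case = solve-∀
... | inj₂ r≡1 | x≡ rewrite r≡1 = _ , trans (cong (λ y → y *ℤ (y +ℤ + 1)) x≡) (odd-case (x /ℕ 2))
  where
  odd-case : ∀ w → (+ 1 +ℤ w *ℤ + 2) *ℤ ((+ 1 +ℤ w *ℤ + 2) +ℤ + 1) ≡ + 2 *ℤ ((+ 1 +ℤ + 2 *ℤ w) *ℤ (w +ℤ + 1))
  odd-case = solve-∀

difference-parity : ∀ a b → + a - + b ≡ + ((a ℕ.+ b) % 2) +ℤ + 2 *ℤ (+ ((a ℕ.+ b) / 2) - + b)
difference-parity a b = begin
  + a - + b                                  ≡⟨ shift (+ a) (+ b) ⟩
  (+ a +ℤ + b) - + 2 *ℤ + b                  ≡⟨ cong (λ y → y - + 2 *ℤ + b) (sym (ℤ.pos-+ a b)) ⟩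
  + (a ℕ.+ b) - + 2 *ℤ + b                   ≡⟨ cong (λ y → + y - + 2 *ℤ + b) (m≡m%n+[m/n]*n (a ℕ.+ b) 2) ⟩
  + (r ℕ.+ q ℕ.* 2) - + 2 *ℤ + b             ≡⟨ cong (λ y → y - + 2 *ℤ + b) (ℤ.pos-+ r (q ℕ.* 2)) ⟩
  (+ r +ℤ + (q ℕ.* 2)) - + 2 *ℤ + b          ≡⟨ cong (λ y → + r +ℤ y - + 2 *ℤ + b) (ℤ.pos-* q 2) ⟩
  (+ r +ℤ + q *ℤ + 2) - + 2 *ℤ + b           ≡⟨ regroup (+ r) (+ q) (+ b) ⟩
  + r +ℤ + 2 *ℤ (+ q - + b)                  ∎
  where
  open ≡-Reasoning
  r = (a ℕ.+ b) % 2
  q = (a ℕ.+ b) / 2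
  shift : ∀ a b → a - b ≡ (a +ℤ b) - + 2 *ℤ b
  shift = solve-∀
  regroup : ∀ r q b → (r +ℤ q *ℤ + 2) - + 2 *ℤ b ≡ r +ℤ + 2 *ℤ (q - b)
  regroup = solve-∀

[a%n+b]%n≡[a+b]%n : ∀ a b n .{{_ : NonZero n}} → (a % n ℕ.+ b) % n ≡ (a ℕ.+ b) % n
[a%n+b]%n≡[a+b]%n a b n = begin
  (a % n ℕ.+ b) % n            ≡⟨ %-distribˡ-+ (a % n) b n ⟩
  (a % n % n ℕ.+ b % n) % n    ≡⟨ cong (λ x → (x ℕ.+ b % n) % n) (m%n%n≡m%n a n) ⟩
  (a % n ℕ.+ b % n) % n        ≡⟨ %-distribˡ-+ a b n ⟨
  (a ℕ.+ b) % n                ∎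
  where open ≡-Reasoning

module Rotation (m : ℕ) .{{_ : NonZero m}} where

  rotate : ℕ → Fin m → Fin m
  rotate k ℓ = fromℕ< (m%n<n (toℕ ℓ ℕ.+ k) m)

  rotate-rotate : ∀ {k k′} → m ∣ k ℕ.+ k′ → ∀ ℓ → rotate k′ (rotate k ℓ) ≡ ℓ
  rotate-rotate {k} {k′} m∣k+k′ ℓ = toℕ-injective (begin
    toℕ (rotate k′ (rotate k ℓ))     ≡⟨ toℕ-fromℕ< _ ⟩
    (toℕ (rotate k ℓ) ℕ.+ k′) % m    ≡⟨ cong (λ x → (x ℕ.+ k′) % m) (toℕ-fromℕ< _) ⟩
    ((toℕ ℓ ℕ.+ k) % m ℕ.+ k′) % m   ≡⟨ [a%n+b]%n≡[a+b]%n (toℕ ℓ ℕ.+ k) k′ m ⟩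
    (toℕ ℓ ℕ.+ k ℕ.+ k′) % m         ≡⟨ cong (_% m) (ℕ.+-assoc (toℕ ℓ) k k′) ⟩
    (toℕ ℓ ℕ.+ (k ℕ.+ k′)) % m       ≡⟨ %-remove-+ʳ (toℕ ℓ) m∣k+k′ ⟩
    toℕ ℓ % m                        ≡⟨ m<n⇒m%n≡m (toℕ<n ℓ) ⟩
    toℕ ℓ                            ∎)
    where open ≡-Reasoning

  m∣k+k*pred[m] : ∀ k → m ∣ k ℕ.+ k ℕ.* pred m
  m∣k+k*pred[m] k = ℕ.divides k (begin
    k ℕ.+ k ℕ.* pred m      ≡⟨ ℕ.*-suc k (pred m) ⟨
    k ℕ.* ℕ.suc (pred m)    ≡⟨ cong (k ℕ.*_) (ℕ.suc-pred m) ⟩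
    k ℕ.* m                 ∎)
    where open ≡-Reasoning

  unrotate-rotate : ∀ k ℓ → rotate (k ℕ.* pred m) (rotate k ℓ) ≡ ℓ
  unrotate-rotate k = rotate-rotate (m∣k+k*pred[m] k)

  rotate-unrotate : ∀ k ℓ → rotate k (rotate (k ℕ.* pred m) ℓ) ≡ ℓ
  rotate-unrotate k = rotate-rotate (subst (m ∣_) (ℕ.+-comm k (k ℕ.* pred m)) (m∣k+k*pred[m] k))

module Shear (m : ℕ) .{{_ : NonZero m}} (s : ℕ) where

  open Rotation m

  shear : Fin m × Fin m → Fin (m ℕ.* m)
  shear (i , ℓ) = combine (rotate (s ℕ.* toℕ i) ℓ) i

  unshear′ : Fin m × Fin m → Fin m × Fin m
  unshear′ (q , i) = i , rotate (s ℕ.* toℕ i ℕ.* pred m) q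

  unshear : Fin (m ℕ.* m) → Fin m × Fin m
  unshear y = unshear′ (remQuot {m} m y)

  shear-unshear : ∀ y → shear (unshear y) ≡ y
  shear-unshear y = trans (shear-unshear′ (remQuot {m} m y)) (combine-remQuot {m} m y)
    where
    shear-unshear′ : ∀ p → shear (unshear′ p) ≡ uncurry combine p
    shear-unshear′ (q , i) = cong (λ r → combine r i) (rotate-unrotate (s ℕ.* toℕ i) q)

  unshear-shear : ∀ x → unshear (shear x) ≡ x
  unshear-shear (i , ℓ) = begin
    unshear′ (remQuot {m} m (combine r i))   ≡⟨ cong unshear′ (remQuot-combine r i) ⟩
    i , rotate (s ℕ.* toℕ i ℕ.* pred m) r    ≡⟨ cong (i ,_) (unrotate-rotate (s ℕ.* toℕ i) ℓ) ⟩
    i , ℓ                                    ∎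
    where
    open ≡-Reasoning
    r = rotate (s ℕ.* toℕ i) ℓ

  shear-↔ : (Fin m × Fin m) ↔ Fin (m ℕ.* m)
  shear-↔ = mk↔ₛ′ shear unshear shear-unshear unshear-shear

  shear-quotient : Fin m → Fin m → ℕ
  shear-quotient i ℓ = (toℕ ℓ ℕ.+ s ℕ.* toℕ i) / m

  toℕ-shear : ∀ i ℓ → toℕ (shear (i , ℓ)) ℕ.+ m ℕ.* m ℕ.* shear-quotient i ℓ ≡ toℕ i ℕ.+ m ℕ.* (toℕ ℓ ℕ.+ s ℕ.* toℕ i)
  toℕ-shear i ℓ = begin
    toℕ (combine (rotate (s ℕ.* toℕ i) ℓ) i) ℕ.+ m ℕ.* m ℕ.* (x / m)
      ≡⟨ cong (ℕ._+ m ℕ.* m ℕ.* (x / m)) (toℕ-combine (rotate (s ℕ.* toℕ i) ℓ) i) ⟩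
    m ℕ.* toℕ (rotate (s ℕ.* toℕ i) ℓ) ℕ.+ toℕ i ℕ.+ m ℕ.* m ℕ.* (x / m)
      ≡⟨ cong (λ r → m ℕ.* r ℕ.+ toℕ i ℕ.+ m ℕ.* m ℕ.* (x / m)) (toℕ-fromℕ< _) ⟩
    m ℕ.* (x % m) ℕ.+ toℕ i ℕ.+ m ℕ.* m ℕ.* (x / m)
      ≡⟨ regroup m (x % m) (x / m) (toℕ i) ⟩
    toℕ i ℕ.+ m ℕ.* (x % m ℕ.+ (x / m) ℕ.* m)
      ≡⟨ cong (λ y → toℕ i ℕ.+ m ℕ.* y) (m≡m%n+[m/n]*n x m) ⟨
    toℕ i ℕ.+ m ℕ.* x
      ∎
    where
    open ≡-Reasoning
    x = toℕ ℓ ℕ.+ s ℕ.* toℕ i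
    regroup : ∀ m r q i → m ℕ.* r ℕ.+ i ℕ.+ m ℕ.* m ℕ.* q ≡ i ℕ.+ m ℕ.* (r ℕ.+ q ℕ.* m)
    regroup = ℕ-solve-∀

  toℤ-shear : ∀ i ℓ →
    + toℕ (shear (i , ℓ)) +ℤ + m *ℤ + m *ℤ + shear-quotient i ℓ ≡ + toℕ i +ℤ + m *ℤ (+ toℕ ℓ +ℤ + s *ℤ + toℕ i)
  toℤ-shear i ℓ = begin
    + toℕ (shear (i , ℓ)) +ℤ + m *ℤ + m *ℤ + (x / m)      ≡⟨ cong (λ y → + toℕ (shear (i , ℓ)) +ℤ y *ℤ + (x / m)) (ℤ.pos-* m m) ⟨
    + toℕ (shear (i , ℓ)) +ℤ + (m ℕ.* m) *ℤ + (x / m)     ≡⟨ cong (+ toℕ (shear (i , ℓ)) +ℤ_) (ℤ.pos-* (m ℕ.* m) (x / m)) ⟨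
    + toℕ (shear (i , ℓ)) +ℤ + (m ℕ.* m ℕ.* (x / m))      ≡⟨ ℤ.pos-+ (toℕ (shear (i , ℓ))) _ ⟨
    + (toℕ (shear (i , ℓ)) ℕ.+ m ℕ.* m ℕ.* (x / m))       ≡⟨ cong +_ (toℕ-shear i ℓ) ⟩
    + (toℕ i ℕ.+ m ℕ.* x)                                 ≡⟨ ℤ.pos-+ (toℕ i) (m ℕ.* x) ⟩
    + toℕ i +ℤ + (m ℕ.* x)                                ≡⟨ cong (+ toℕ i +ℤ_) (ℤ.pos-* m x) ⟩
    + toℕ i +ℤ + m *ℤ + x                                 ≡⟨ cong (λ y → + toℕ i +ℤ + m *ℤ y) (ℤ.pos-+ (toℕ ℓ) (s ℕ.* toℕ i)) ⟩
    + toℕ i +ℤ + m *ℤ (+ toℕ ℓ +ℤ + (s ℕ.* toℕ i))        ≡⟨ cong (λ y → + toℕ i +ℤ + m *ℤ (+ toℕ ℓ +ℤ y)) (ℤ.pos-* s (toℕ i)) ⟩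
    + toℕ i +ℤ + m *ℤ (+ toℕ ℓ +ℤ + s *ℤ + toℕ i)         ∎
    where
    open ≡-Reasoning
    x = toℕ ℓ ℕ.+ s ℕ.* toℕ i

x+y≡z⇒x≡z-y : ∀ x y {z} → x +ℤ y ≡ z → x ≡ z - y
x+y≡z⇒x≡z-y x y refl = cancel x y
  where
  cancel : ∀ x y → x ≡ (x +ℤ y) - y
  cancel = solve-∀

W1base : ℤ → ℤ → ℤ → ℤ
W1base M L d = + 2 *ℤ M *ℤ L *ℤ d +ℤ d *ℤ d +ℤ M *ℤ d

module Exponents (M : ℤ) where

  open Modulo (+ 2 *ℤ M *ℤ M)

  D[D+M]≈W1base : ∀ δ L s K → let D = δ +ℤ M *ℤ (L +ℤ s *ℤ δ +ℤ M *ℤ K) in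
    D *ℤ (D +ℤ M) ≈ W1base M L δ +ℤ + 2 *ℤ M *ℤ s *ℤ (δ *ℤ δ)
  D[D+M]≈W1base δ L s K with x[x+1]-even (L +ℤ s *ℤ δ +ℤ M *ℤ K)
  ... | v , X[X+1]≡2v = ≈-by (δ *ℤ K +ℤ v) (begin
    D *ℤ (D +ℤ M)                                          ≡⟨ expand δ L s K M ⟩
    RHS +ℤ M *ℤ M *ℤ (X *ℤ (X +ℤ + 1)) +ℤ δ *ℤ K *ℤ 2M²     ≡⟨ cong (λ y → RHS +ℤ M *ℤ M *ℤ y +ℤ δ *ℤ K *ℤ 2M²) X[X+1]≡2v ⟩
    RHS +ℤ M *ℤ M *ℤ (+ 2 *ℤ v) +ℤ δ *ℤ K *ℤ 2M²           ≡⟨ collect RHS M v δ K ⟩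
    RHS +ℤ (δ *ℤ K +ℤ v) *ℤ 2M²                             ∎)
    where
    open ≡-Reasoning
    X = L +ℤ s *ℤ δ +ℤ M *ℤ K
    D = δ +ℤ M *ℤ X
    2M² = + 2 *ℤ M *ℤ M
    RHS = W1base M L δ +ℤ + 2 *ℤ M *ℤ s *ℤ (δ *ℤ δ)
    expand : ∀ δ L s K M → let X = L +ℤ s *ℤ δ +ℤ M *ℤ K; D = δ +ℤ M *ℤ X in
      D *ℤ (D +ℤ M) ≡
        (+ 2 *ℤ M *ℤ L *ℤ δ +ℤ δ *ℤ δ +ℤ M *ℤ δ) +ℤ + 2 *ℤ M *ℤ s *ℤ (δ *ℤ δ)
          +ℤ M *ℤ M *ℤ (X *ℤ (X +ℤ + 1)) +ℤ δ *ℤ K *ℤ (+ 2 *ℤ M *ℤ M)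
    expand = solve-∀
    collect : ∀ R M v δ K →
      R +ℤ M *ℤ M *ℤ (+ 2 *ℤ v) +ℤ δ *ℤ K *ℤ (+ 2 *ℤ M *ℤ M) ≡ R +ℤ (δ *ℤ K +ℤ v) *ℤ (+ 2 *ℤ M *ℤ M)
    collect = solve-∀

  Wexp-shear : ∀ I J ℓ ℓ′ s qa qb Da Db →
    Da +ℤ M *ℤ M *ℤ qa ≡ I +ℤ M *ℤ (ℓ +ℤ s *ℤ I) →
    Db +ℤ M *ℤ M *ℤ qb ≡ J +ℤ M *ℤ (ℓ′ +ℤ s *ℤ J) →
    (Db - Da) *ℤ (Db - Da - M) ≈ W1base M (ℓ - ℓ′) (I - J) +ℤ + 2 *ℤ M *ℤ s *ℤ ((I - J) *ℤ (I - J))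
  Wexp-shear I J ℓ ℓ′ s qa qb Da Db eqa eqb = begin
    (Db - Da) *ℤ (Db - Da - M)
      ≡⟨ cong₂ (λ a b → (b - a) *ℤ (b - a - M)) (x+y≡z⇒x≡z-y Da _ eqa) (x+y≡z⇒x≡z-y Db _ eqb) ⟩
    (Db′ - Da′) *ℤ (Db′ - Da′ - M)     ≡⟨ negate I J ℓ ℓ′ s qa qb M ⟩
    D *ℤ (D +ℤ M)                      ≈⟨ D[D+M]≈W1base (I - J) (ℓ - ℓ′) s (qb - qa) ⟩
    W1base M (ℓ - ℓ′) (I - J) +ℤ + 2 *ℤ M *ℤ s *ℤ ((I - J) *ℤ (I - J)) ∎
    where
    open ≈-Reasoning
    Da′ = I +ℤ M *ℤ (ℓ +ℤ s *ℤ I) - M *ℤ M *ℤ qa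
    Db′ = J +ℤ M *ℤ (ℓ′ +ℤ s *ℤ J) - M *ℤ M *ℤ qb
    D = (I - J) +ℤ M *ℤ ((ℓ - ℓ′) +ℤ s *ℤ (I - J) +ℤ M *ℤ (qb - qa))
    negate : ∀ I J ℓ ℓ′ s qa qb M →
      let Da′ = I +ℤ M *ℤ (ℓ +ℤ s *ℤ I) - M *ℤ M *ℤ qa
          Db′ = J +ℤ M *ℤ (ℓ′ +ℤ s *ℤ J) - M *ℤ M *ℤ qb
          D = (I - J) +ℤ M *ℤ ((ℓ - ℓ′) +ℤ s *ℤ (I - J) +ℤ M *ℤ (qb - qa))
      in (Db′ - Da′) *ℤ (Db′ - Da′ - M) ≡ D *ℤ (D +ℤ M)
    negate = solve-∀

module _ (m : ℕ) (e : ℤ) (i ℓ j ℓ′ : Fin m) where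

  private
    base : ℤ
    base = W1base (+ m) (+ toℕ ℓ - + toℕ ℓ′) (+ toℕ i - + toℕ j)

    base-with : ℤ → ℤ
    base-with k = k *ℤ (+ toℕ ℓ - + toℕ ℓ′) *ℤ d +ℤ d *ℤ d +ℤ + m *ℤ d
      where d = + toℕ i - + toℕ j

  W1exp-even : (toℕ i ℕ.+ toℕ j) % 2 ≡ 0 → W1exp m e (i , ℓ) (j , ℓ′) ≡ base +ℤ + 3 *ℤ e
  W1exp-even i+j%2≡0 rewrite i+j%2≡0 = cong (λ k → base-with k +ℤ + 3 *ℤ e) (ℤ.pos-* 2 m)

  W1exp-odd : (toℕ i ℕ.+ toℕ j) % 2 ≡ 1 → W1exp m e (i , ℓ) (j , ℓ′) ≡ base
  W1exp-odd i+j%2≡1 rewrite i+j%2≡1 = cong base-with (ℤ.pos-* 2 m)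

N≡2*m*m : ∀ m → N m ≡ + 2 *ℤ + m *ℤ + m
N≡2*m*m m = trans (ℤ.pos-* (2 ℕ.* m) m) (cong (_*ℤ + m) (ℤ.pos-* 2 m))

FourthRoot⇒2m²∣4e : ∀ {m e} → FourthRoot m e → (+ 2 *ℤ + m *ℤ + m) Signed.∣ + 4 *ℤ e
FourthRoot⇒2m²∣4e {m} u⁴≡1 = subst (Signed._∣ _) (N≡2*m*m m) (∣ᵤ⇒∣ u⁴≡1)

≈⇒≡[m] : ∀ {m x y} → Modulo._≈_ (+ 2 *ℤ + m *ℤ + m) x y → x ≡[ m ] y
≈⇒≡[m] {m} (Modulo.∣⇒≈ x-y) = ∣⇒∣ᵤ (subst (Signed._∣ _) (sym (N≡2*m*m m)) x-y)

FourthRoot-*ˡ : ∀ {m e} k → FourthRoot m e → FourthRoot m (k *ℤ e)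
FourthRoot-*ˡ {m} {e} k u⁴≡1 = ∣⇒∣ᵤ (subst (N m Signed.∣_) (swap k e) (Signed.∣n⇒∣m*n k (∣ᵤ⇒∣ u⁴≡1)))
  where
  swap : ∀ k e → k *ℤ (+ 4 *ℤ e) ≡ + 4 *ℤ (k *ℤ e)
  swap = solve-∀

FourthRoot⇒2m∣e : ∀ {m e} → 4 ∣ m → FourthRoot m e → (+ 2 *ℤ + m) Signed.∣ e
FourthRoot⇒2m∣e {m} {e} (ℕ.divides t m≡t*4) u⁴≡1 with ∣ᵤ⇒∣ u⁴≡1
... | divides c 4e≡c*N = divides (c *ℤ + t) (ℤ.*-cancelˡ-≡ (+ 4) e _ (begin
  + 4 *ℤ e                               ≡⟨ 4e≡c*N ⟩
  c *ℤ N m                               ≡⟨ cong (c *ℤ_) (N≡2*m*m m) ⟩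
  c *ℤ (+ 2 *ℤ + m *ℤ + m)               ≡⟨ cong (λ x → c *ℤ (+ 2 *ℤ + m *ℤ + x)) m≡t*4 ⟩
  c *ℤ (+ 2 *ℤ + m *ℤ + (t ℕ.* 4))       ≡⟨ cong (λ x → c *ℤ (+ 2 *ℤ + m *ℤ x)) (ℤ.pos-* t 4) ⟩
  c *ℤ (+ 2 *ℤ + m *ℤ (+ t *ℤ + 4))      ≡⟨ regroup c (+ m) (+ t) ⟩
  + 4 *ℤ (c *ℤ + t *ℤ (+ 2 *ℤ + m))      ∎))
  where
  open ≡-Reasoning
  regroup : ∀ c M t → c *ℤ (+ 2 *ℤ M *ℤ (t *ℤ + 4)) ≡ + 4 *ℤ (c *ℤ t *ℤ (+ 2 *ℤ M))
  regroup = solve-∀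

module _ (m : ℕ) .{{_ : NonZero m}} where

  open Modulo (+ 2 *ℤ + m *ℤ + m)

  2m∣e⇒e≈2ms : ∀ {e} → (+ 2 *ℤ + m) Signed.∣ e → ∃ λ s → e ≈ + 2 *ℤ + m *ℤ + s
  2m∣e⇒e≈2ms {e} (divides h e≡h*2m) = h %ℕ m , ≈-by (h /ℕ m) (begin
    e                                                            ≡⟨ e≡h*2m ⟩
    h *ℤ (+ 2 *ℤ + m)                                            ≡⟨ cong (_*ℤ (+ 2 *ℤ + m)) (a≡a%ℕn+[a/ℕn]*n h m) ⟩
    (+ (h %ℕ m) +ℤ (h /ℕ m) *ℤ + m) *ℤ (+ 2 *ℤ + m)              ≡⟨ regroup (+ (h %ℕ m)) (h /ℕ m) (+ m) ⟩
    + 2 *ℤ + m *ℤ + (h %ℕ m) +ℤ (h /ℕ m) *ℤ (+ 2 *ℤ + m *ℤ + m)  ∎)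
    where
    open ≡-Reasoning
    regroup : ∀ s q M → (s +ℤ q *ℤ M) *ℤ (+ 2 *ℤ M) ≡ + 2 *ℤ M *ℤ s +ℤ q *ℤ (+ 2 *ℤ M *ℤ M)
    regroup = solve-∀

  module Entries {e : ℤ} {s : ℕ} (e≈2ms : e ≈ + 2 *ℤ + m *ℤ + s)
                 (u⁴≡1 : (+ 2 *ℤ + m *ℤ + m) Signed.∣ + 4 *ℤ e) where

    open Shear m s
    open Exponents (+ m)

    Wexp-at-shear : ∀ i ℓ j ℓ′ → let δ = + toℕ i - + toℕ j in
      Wexp m (shear (i , ℓ)) (shear (j , ℓ′)) ≈ W1base (+ m) (+ toℕ ℓ - + toℕ ℓ′) δ +ℤ + 2 *ℤ + m *ℤ + s *ℤ (δ *ℤ δ)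
    Wexp-at-shear i ℓ j ℓ′ =
      Wexp-shear (+ toℕ i) (+ toℕ j) (+ toℕ ℓ) (+ toℕ ℓ′) (+ s) (+ shear-quotient i ℓ) (+ shear-quotient j ℓ′)
                 (+ toℕ (shear (i , ℓ))) (+ toℕ (shear (j , ℓ′))) (toℤ-shear i ℓ) (toℤ-shear j ℓ′)

    entry-exponent : ∀ i ℓ j ℓ′ → let r = + ((toℕ i ℕ.+ toℕ j) % 2) in
      + 3 *ℤ e +ℤ Wexp m (shear (i , ℓ)) (shear (j , ℓ′)) ≈
      + 3 *ℤ e +ℤ (W1base (+ m) (+ toℕ ℓ - + toℕ ℓ′) (+ toℕ i - + toℕ j) +ℤ e *ℤ (r *ℤ r))
    entry-exponent i ℓ j ℓ′ = begin
      + 3 *ℤ e +ℤ Wexp m (shear (i , ℓ)) (shear (j , ℓ′))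
        ≈⟨ +-congˡ (+ 3 *ℤ e) (Wexp-at-shear i ℓ j ℓ′) ⟩
      + 3 *ℤ e +ℤ (B +ℤ + 2 *ℤ + m *ℤ + s *ℤ (δ *ℤ δ))
        ≈⟨ +-congˡ (+ 3 *ℤ e) (+-congˡ B (*-congʳ (δ *ℤ δ) (≈-sym e≈2ms))) ⟩
      + 3 *ℤ e +ℤ (B +ℤ e *ℤ (δ *ℤ δ))
        ≡⟨ cong (λ d → + 3 *ℤ e +ℤ (B +ℤ e *ℤ (d *ℤ d))) (difference-parity (toℕ i) (toℕ j)) ⟩
      + 3 *ℤ e +ℤ (B +ℤ e *ℤ ((r +ℤ + 2 *ℤ w) *ℤ (r +ℤ + 2 *ℤ w)))
        ≈⟨ +-congˡ (+ 3 *ℤ e) (+-congˡ B (e[r+2w]²≈er² u⁴≡1 r w)) ⟩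
      + 3 *ℤ e +ℤ (B +ℤ e *ℤ (r *ℤ r))
        ∎
      where
      open ≈-Reasoning
      δ = + toℕ i - + toℕ j
      B = W1base (+ m) (+ toℕ ℓ - + toℕ ℓ′) δ
      r = + ((toℕ i ℕ.+ toℕ j) % 2)
      w = + ((toℕ i ℕ.+ toℕ j) / 2) - + toℕ j

    entry : ∀ α β → + 3 *ℤ e +ℤ Wexp m (shear α) (shear β) ≈ W1exp m e α β
    entry (i , ℓ) (j , ℓ′) =
      ≈-trans (entry-exponent i ℓ j ℓ′) (by-parity (r<2⇒r≡0⊎r≡1 (m%n<n (toℕ i ℕ.+ toℕ j) 2)))
      where
      open ≈-Reasoning
      B = W1base (+ m) (+ toℕ ℓ - + toℕ ℓ′) (+ toℕ i - + toℕ j)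
      r = (toℕ i ℕ.+ toℕ j) % 2
      by-parity : r ≡ 0 ⊎ r ≡ 1 → + 3 *ℤ e +ℤ (B +ℤ e *ℤ (+ r *ℤ + r)) ≈ W1exp m e (i , ℓ) (j , ℓ′)
      by-parity (inj₁ r≡0) = begin
        + 3 *ℤ e +ℤ (B +ℤ e *ℤ (+ r *ℤ + r))  ≡⟨ cong (λ k → + 3 *ℤ e +ℤ (B +ℤ e *ℤ (+ k *ℤ + k))) r≡0 ⟩
        + 3 *ℤ e +ℤ (B +ℤ e *ℤ (+ 0 *ℤ + 0))  ≡⟨ even e B ⟩
        B +ℤ + 3 *ℤ e                          ≡⟨ W1exp-even m e i ℓ j ℓ′ r≡0 ⟨
        W1exp m e (i , ℓ) (j , ℓ′)             ∎
        where
        even : ∀ e B → + 3 *ℤ e +ℤ (B +ℤ e *ℤ (+ 0 *ℤ + 0)) ≡ B +ℤ + 3 *ℤ e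
        even = solve-∀
      by-parity (inj₂ r≡1) = begin
        + 3 *ℤ e +ℤ (B +ℤ e *ℤ (+ r *ℤ + r))  ≡⟨ cong (λ k → + 3 *ℤ e +ℤ (B +ℤ e *ℤ (+ k *ℤ + k))) r≡1 ⟩
        + 3 *ℤ e +ℤ (B +ℤ e *ℤ (+ 1 *ℤ + 1))  ≡⟨ odd e B ⟩
        B +ℤ + 4 *ℤ e                          ≈⟨ +-congˡ B (∣⇒≈0 u⁴≡1) ⟩
        B +ℤ + 0                               ≡⟨ ℤ.+-identityʳ B ⟩
        B                                      ≡⟨ W1exp-odd m e i ℓ j ℓ′ r≡1 ⟨
        W1exp m e (i , ℓ) (j , ℓ′)             ∎
        where
        odd : ∀ e B → + 3 *ℤ e +ℤ (B +ℤ e *ℤ (+ 1 *ℤ + 1)) ≡ B +ℤ + 4 *ℤ e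
        odd = solve-∀

proposition6p3 : (m : ℕ) → 0 < m → 4 ∣ m → (e : ℤ) → FourthRoot m e →
    Σ ((Fin m × Fin m) ⤖ Fin (m * m)) λ ψ → Σ ℤ λ f → FourthRoot m f ×
      ((α β : Fin m × Fin m) →
        (f +ℤ Wexp m (Bijection.to ψ α) (Bijection.to ψ β)) ≡[ m ] W1exp m e α β)
proposition6p3 0 ()
proposition6p3 m@(ℕ.suc _) _ 4∣m e u⁴≡1 with 2m∣e⇒e≈2ms m (FourthRoot⇒2m∣e {m} {e} 4∣m u⁴≡1)
... | s , e≈2ms =
  ↔⇒⤖ shear-↔ , + 3 *ℤ e , FourthRoot-*ˡ {m} {e} (+ 3) u⁴≡1 , λ α β → ≈⇒≡[m] {m} (entry α β)
  where
  open Shear m s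
  open Entries m e≈2ms (FourthRoot⇒2m²∣4e {m} {e} u⁴≡1)
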